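{- For every $n\in\mathbb{N}$ there is a bijection between $\mathsf{APS}_n$ and $\{S\in\mathsf{APS}^B_n : S\subset -\mathbb{N}\}$.
   Context: $\mathbb{N}=\{1,2,3,\dots\}$, $[n]=\{1,\dots,n\}$, $-X=\{ -x:x\in X\}$, $\pm[n]=[n]\cup-[n]$. $\mathfrak{S}_n$ is the symmetric group on $[n]$ and $\mathfrak{S}_n^B$ is the group of bijections $w:\pm[n]\to\pm[n]$ with $w(-i)=-w(i)$, both written in one-line notation $w(1)\cdots w(n)$. A pinnacle of $w$ is a value $w(i)$ with $2\le i\le n-1$ and $w(i-1)<w(i)>w(i+1)$; the pinnacle set of $w$ is the set of its pinnacles. $\mathsf{APS}_n$ (resp. $\mathsf{APS}^B_n$) is the set of pinnacle sets of elements of $\mathfrak{S}_n$ (resp. $\mathfrak{S}_n^B$). -}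

module Defs where

open import Level using (0ℓ)
open import Data.Nat using (ℕ; suc)
open import Data.Integer using (ℤ; +_; _<_; _≤_; ∣_∣; 0ℤ)
import Data.Nat as N
open import Data.Fin using (Fin; toℕ)
open import Data.List using (List)
open import Data.List.Membership.Propositional using (_∈_)
open import Data.Product using (Σ; ∃; ∃-syntax; _×_; _,_; proj₁)
open import Function using (_∘_; _⇔_)
open import Function.Definitions using (Injective)
open import Relation.Binary.PropositionalEquality using (_≡_)
open import Relation.Binary.Bundles using (Setoid)
open import Relation.Binary.Structures using (IsEquivalence)
open import Function.Bundles using (mk⇔; Equivalence)

-- One-line notation w(1)…w(n) of a map [n] → ℤ, indexed 0-based by Fin n.
OneLine : ℕ → Set
OneLine n = Fin n → ℤ

-- w ∈ 𝔖ₙ : values in [n], injective (hence a bijection of [n]).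
IsPerm : (n : ℕ) → OneLine n → Set
IsPerm n w = (∀ i → (+ 1 ≤ w i) × (w i ≤ + n)) × Injective _≡_ _≡_ w

-- w ∈ 𝔖ᴮₙ (one-line notation w(1)…w(n)) : values in ±[n] and
-- i ↦ |w(i)| injective; such w extend uniquely to signed bijections of ±[n].
IsSignedPerm : (n : ℕ) → OneLine n → Set
IsSignedPerm n w = (∀ i → (1 N.≤ ∣ w i ∣) × (∣ w i ∣ N.≤ n)) × Injective _≡_ _≡_ (∣_∣ ∘ w)

-- v is a pinnacle of w: v = w(j) for a position j with neighbours i = j-1,
-- k = j+1 (so 2 ≤ j ≤ n-1 in 1-based indexing) and w(i) < w(j) > w(k).
IsPinnacle : {n : ℕ} → OneLine n → ℤ → Set
IsPinnacle {n} w v = ∃[ i ] ∃[ j ] ∃[ k ]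
  (toℕ j ≡ suc (toℕ i)) × (toℕ k ≡ suc (toℕ j)) × (w i < w j) × (w k < w j) × (v ≡ w j)

-- S (a finite set of integers, given by a list of its elements) is the pinnacle set of w.
IsPinnacleSetOf : {n : ℕ} → List ℤ → OneLine n → Set
IsPinnacleSetOf S w = ∀ v → (v ∈ S) ⇔ IsPinnacle w v

_≐_ : List ℤ → List ℤ → Set
S ≐ T = ∀ v → (v ∈ S) ⇔ (v ∈ T)

APS : ℕ → Set
APS n = Σ (List ℤ) λ S → ∃[ w ] IsPerm n w × IsPinnacleSetOf S w

APSBneg : ℕ → Set
APSBneg n = Σ (List ℤ) λ S →
  (∃[ w ] IsSignedPerm n w × IsPinnacleSetOf S w) × (∀ v → v ∈ S → v < 0ℤ)

≐-isEquivalence : IsEquivalence _≐_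
≐-isEquivalence = record
  { refl = λ v → mk⇔ (λ x → x) (λ x → x)
  ; sym = λ p v → mk⇔ (Equivalence.from (p v)) (Equivalence.to (p v))
  ; trans = λ p q v → mk⇔ (λ x → Equivalence.to (q v) (Equivalence.to (p v) x))
                          (λ x → Equivalence.from (p v) (Equivalence.from (q v) x))
  }

-- Setoids whose elements are sets, compared as sets (proof components ignored).
module _ (A : Set) (set : A → List ℤ) where
  SetsSetoid : Setoid 0ℓ 0ℓ
  SetsSetoid = record
    { Carrier = A
    ; _≈_ = λ x y → set x ≐ set y
    ; isEquivalence = record
      { refl = IsEquivalence.refl ≐-isEquivalence
      ; sym = IsEquivalence.sym ≐-isEquivalence
      ; trans = IsEquivalence.trans ≐-isEquivalence } }

APS-setoid : ℕ → Setoid 0ℓ 0ℓ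
APS-setoid n = SetsSetoid (APS n) proj₁

APSBneg-setoid : ℕ → Setoid 0ℓ 0ℓ
APSBneg-setoid n = SetsSetoid (APSBneg n) proj₁

{-# OPTIONS --safe #-}
module Submission where

-- Shifting every value down by n + 1 turns a permutation of [n] into a signed permutation
-- with all entries in -[n], and carries its pinnacle set along; since the shift is strictly
-- increasing and invertible, S ↦ S - (n + 1) is well defined and injective on pinnacle sets.
-- Conversely, let u be a signed permutation whose pinnacles are all negative.  Its largest
-- entry, when positive, cannot be a pinnacle, so it sits at one end of the word; removing
-- it, treating the rest recursively, and re-inserting its negative at a place where it
-- neither creates nor destroys a pinnacle yields an arrangement of -|u(1)|, …, -|u(n)| with
-- the same pinnacle set.  Shifting that arrangement up by n + 1 gives a permutation of [n]
-- whose pinnacle set is that of u shifted up by n + 1.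

open import Defs
open import Algebra.Bundles using (AbelianGroup)
open import Data.Fin using (zero; suc)
open import Data.Integer
  using (ℤ; +_; -[1+_]; _+_; _-_; -_; ∣_∣; _<_; _≤_; _<?_; _≤?_; 0ℤ; +≤+; -<+)
import Data.Integer.Properties as ℤ
open import Data.List
  using (List; []; _∷_; _++_; map; length; reverse; tabulate; lookup; _ʳ++_)
import Data.List.Properties as List
open import Data.List.Membership.Propositional using (_∈_)
open import Data.List.Membership.Propositional.Properties
  using (∈-map⁺; ∈-map⁻; ∈-lookup; ∈-++⁺ʳ)
open import Data.List.Relation.Binary.Permutation.Propositional
  using (_↭_; ↭-refl; ↭-sym; ↭-trans; ↭-reflexive; prep; swap; ↭⇒↭ₛ)
open import Data.List.Relation.Binary.Permutation.Propositional.Properties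
  using (All-resp-↭; ↭-length; ↭-reverse)
import Data.List.Relation.Binary.Permutation.Propositional.Properties as ↭
open import Data.List.Relation.Binary.Permutation.Setoid.Properties using (Unique-resp-↭)
import Data.List.Relation.Binary.Subset.Propositional.Properties as ⊆
open import Data.List.Relation.Unary.All as All using (All; []; _∷_)
import Data.List.Relation.Unary.All.Properties as All
open import Data.List.Relation.Unary.AllPairs using (_∷_)
open import Data.List.Relation.Unary.Any using (here)
open import Data.List.Relation.Unary.Unique.Propositional using (Unique)
import Data.List.Relation.Unary.Unique.Propositional.Properties as Unique
open import Data.Nat as ℕ using (ℕ; zero; suc)
import Data.Nat.Properties as ℕ
open import Data.Product using (∃-syntax; _×_; _,_; proj₁; proj₂)
open import Data.Unit using (⊤; tt)
open import Function using (_∘_; _⇔_; mk⇔; Equivalence; Injective; Inverse; Bijection)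
import Function.Properties.Equivalence as ⇔
open import Function.Properties.Inverse using (Inverse⇒Bijection)
open import Relation.Binary.Core using (_Preserves_⟶_)
open import Relation.Binary.Definitions using (tri<; tri≈; tri>)
open import Relation.Binary.PropositionalEquality
  using (_≡_; refl; sym; trans; cong; subst; setoid)
open import Relation.Nullary using (¬_; Dec; yes; no; contradiction)
open import Algebra.Properties.Group (AbelianGroup.group ℤ.+-0-abelianGroup)
  using (//-rightDividesˡ; //-rightDividesʳ; ∙-cancelʳ)

-- Pinnacles of words

data Pinnacle : List ℤ → ℤ → Set where
  here  : ∀ {a b c xs} → a < b → c < b → Pinnacle (a ∷ b ∷ c ∷ xs) b
  there : ∀ {x xs v} → Pinnacle xs v → Pinnacle (x ∷ xs) v

infix 4 _≈ₚ_

_≈ₚ_ : List ℤ → List ℤ → Set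
xs ≈ₚ ys = ∀ v → Pinnacle xs v ⇔ Pinnacle ys v

≈ₚ-refl : ∀ {xs} → xs ≈ₚ xs
≈ₚ-refl _ = ⇔.refl

≈ₚ-sym : ∀ {xs ys} → xs ≈ₚ ys → ys ≈ₚ xs
≈ₚ-sym p v = ⇔.sym (p v)

≈ₚ-trans : ∀ {xs ys zs} → xs ≈ₚ ys → ys ≈ₚ zs → xs ≈ₚ zs
≈ₚ-trans p q v = ⇔.trans (p v) (q v)

pinnacle-tabulate⁺ : ∀ {n} {w : OneLine n} {v} → IsPinnacle w v → Pinnacle (tabulate w) v
pinnacle-tabulate⁺ (zero , suc zero , suc (suc zero) , refl , refl , wi<wj , wk<wj , refl) =
  here wi<wj wk<wj
pinnacle-tabulate⁺ (suc i , suc j , suc k , j≡1+i , k≡1+j , rest) =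
  there (pinnacle-tabulate⁺ (i , j , k , ℕ.suc-injective j≡1+i , ℕ.suc-injective k≡1+j , rest))
pinnacle-tabulate⁺ (zero , zero , _ , () , _)
pinnacle-tabulate⁺ (zero , suc (suc _) , _ , () , _)
pinnacle-tabulate⁺ (zero , suc zero , zero , _ , () , _)
pinnacle-tabulate⁺ (zero , suc zero , suc zero , _ , () , _)
pinnacle-tabulate⁺ (zero , suc zero , suc (suc (suc _)) , _ , () , _)
pinnacle-tabulate⁺ (suc _ , zero , _ , () , _)
pinnacle-tabulate⁺ (suc _ , suc _ , zero , _ , () , _)

pinnacle-tabulate⁻ : ∀ {n} {w : OneLine n} {v} → Pinnacle (tabulate w) v → IsPinnacle w v
pinnacle-tabulate⁻ {suc (suc (suc _))} (here wi<wj wk<wj) =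
  zero , suc zero , suc (suc zero) , refl , refl , wi<wj , wk<wj , refl
pinnacle-tabulate⁻ {suc _} {w} (there p) with pinnacle-tabulate⁻ {w = w ∘ suc} p
... | i , j , k , j≡1+i , k≡1+j , rest =
  suc i , suc j , suc k , cong suc j≡1+i , cong suc k≡1+j , rest

isPinnacle⇔pinnacle-tabulate : ∀ {n} {w : OneLine n} {v} →
  IsPinnacle w v ⇔ Pinnacle (tabulate w) v
isPinnacle⇔pinnacle-tabulate = mk⇔ pinnacle-tabulate⁺ pinnacle-tabulate⁻

isPinnacleSetOf-lookup : ∀ {n} {w : OneLine n} {S} ys →
  ys ≈ₚ tabulate w → IsPinnacleSetOf S w → IsPinnacleSetOf S (lookup ys)
isPinnacleSetOf-lookup ys ys≈w S-pins v =
  ⇔.trans (S-pins v) (⇔.trans isPinnacle⇔pinnacle-tabulate (⇔.trans (≈ₚ-sym ys≈w v) ys⇔lookup))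
  where
  ys⇔lookup : Pinnacle ys v ⇔ IsPinnacle (lookup ys) v
  ys⇔lookup = subst (λ zs → Pinnacle zs v ⇔ IsPinnacle (lookup ys) v)
                (List.tabulate-lookup ys) (⇔.sym isPinnacle⇔pinnacle-tabulate)

isPinnacle-value : ∀ {n} {w : OneLine n} {v} {P : ℤ → Set} →
  (∀ i → P (w i)) → IsPinnacle w v → P v
isPinnacle-value P-w (_ , j , _ , _ , _ , _ , _ , refl) = P-w j

preserves⇒reflects-< : ∀ {f : ℤ → ℤ} → f Preserves _<_ ⟶ _<_ → ∀ {a b} → f a < f b → a < b
preserves⇒reflects-< f-mono {a} {b} fa<fb with ℤ.<-cmp a b
... | tri< a<b _ _  = a<b
... | tri≈ _ refl _ = contradiction fa<fb (ℤ.<-irrefl refl)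
... | tri> _ _ b<a  = contradiction (f-mono b<a) (ℤ.<-asym fa<fb)

module _ {f : ℤ → ℤ} (f-mono : f Preserves _<_ ⟶ _<_) {n} {w : OneLine n} where

  isPinnacle-map⁺ : ∀ {v} → IsPinnacle w v → IsPinnacle (f ∘ w) (f v)
  isPinnacle-map⁺ (i , j , k , ij , jk , wi<wj , wk<wj , refl) =
    i , j , k , ij , jk , f-mono wi<wj , f-mono wk<wj , refl

  isPinnacle-map⁻ : ∀ {v} → IsPinnacle (f ∘ w) v → ∃[ s ] IsPinnacle w s × v ≡ f s
  isPinnacle-map⁻ (i , j , k , ij , jk , fwi<fwj , fwk<fwj , refl) =
    w j ,
    (i , j , k , ij , jk , preserves⇒reflects-< f-mono fwi<fwj , preserves⇒reflects-< f-mono fwk<fwj , refl) ,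
    refl

  isPinnacleSetOf-map : ∀ {S} → IsPinnacleSetOf S w → IsPinnacleSetOf (map f S) (f ∘ w)
  isPinnacleSetOf-map {S} S-pins v = mk⇔ to from
    where
    to : v ∈ map f S → IsPinnacle (f ∘ w) v
    to v∈fS with ∈-map⁻ f v∈fS
    ... | s , s∈S , v≡fs =
      subst (IsPinnacle (f ∘ w)) (sym v≡fs) (isPinnacle-map⁺ (Equivalence.to (S-pins s) s∈S))
    from : IsPinnacle (f ∘ w) v → v ∈ map f S
    from p with isPinnacle-map⁻ p
    ... | s , s-pin , v≡fs =
      subst (_∈ map f S) (sym v≡fs) (∈-map⁺ f (Equivalence.from (S-pins s) s-pin))

infix 4 _≥ʰ_ _≥ʰ?_

_≥ʰ_ : ℤ → List ℤ → Set
x ≥ʰ []    = ⊤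
x ≥ʰ y ∷ _ = y ≤ x

_≥ʰ?_ : ∀ x ys → Dec (x ≥ʰ ys)
x ≥ʰ? []    = yes tt
x ≥ʰ? y ∷ _ = y ≤? x

All<⇒≥ʰ : ∀ {x ys} → All (_< x) ys → x ≥ʰ ys
All<⇒≥ʰ []        = tt
All<⇒≥ʰ (y<x ∷ _) = ℤ.<⇒≤ y<x

prepend-≥ʰ : ∀ {x ys} → x ≥ʰ ys → x ∷ ys ≈ₚ ys
prepend-≥ʰ {ys = []} _ v = mk⇔ (λ { (there ()) }) (λ ())
prepend-≥ʰ {x} {y ∷ ys} y≤x v = mk⇔ drop there
  where
  drop : Pinnacle (x ∷ y ∷ ys) v → Pinnacle (y ∷ ys) v
  drop (here x<y _) = contradiction x<y (ℤ.≤⇒≯ y≤x)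
  drop (there p)    = p

prepend-ascent : ∀ {a b cs} → ¬ b ≥ʰ cs → a ∷ b ∷ cs ≈ₚ b ∷ cs
prepend-ascent {cs = []} b≱[] = contradiction tt b≱[]
prepend-ascent {a} {b} {c ∷ cs} c≰b v = mk⇔ drop there
  where
  drop : Pinnacle (a ∷ b ∷ c ∷ cs) v → Pinnacle (b ∷ c ∷ cs) v
  drop (here _ c<b) = contradiction (ℤ.<⇒≤ c<b) c≰b
  drop (there p)    = p

pinnacle-between : ∀ {a as M b bs} →
  All (_< M) (a ∷ as) → b < M → Pinnacle ((a ∷ as) ++ M ∷ b ∷ bs) M
pinnacle-between {as = []}    (a<M ∷ []) b<M = here a<M b<M
pinnacle-between {as = _ ∷ _} (_ ∷ as<M) b<M = there (pinnacle-between as<M b<M)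

pinnacle-ʳ++ʳ : ∀ xs {acc v} → Pinnacle acc v → Pinnacle (xs ʳ++ acc) v
pinnacle-ʳ++ʳ []       p = p
pinnacle-ʳ++ʳ (_ ∷ xs) p = pinnacle-ʳ++ʳ xs (there p)

pinnacle-ʳ++ˡ : ∀ {xs acc v} → Pinnacle xs v → Pinnacle (xs ʳ++ acc) v
pinnacle-ʳ++ˡ {_ ∷ _ ∷ _ ∷ xs} (here a<b c<b) = pinnacle-ʳ++ʳ xs (here c<b a<b)
pinnacle-ʳ++ˡ (there p) = pinnacle-ʳ++ˡ p

reverse-≈ₚ : ∀ xs → reverse xs ≈ₚ xs
reverse-≈ₚ xs v = mk⇔ unreverse pinnacle-ʳ++ˡ
  where
  unreverse : Pinnacle (reverse xs) v → Pinnacle xs v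
  unreverse p = subst (λ ys → Pinnacle ys v) (List.reverse-involutive xs) (pinnacle-ʳ++ˡ p)

-- Inserting an entry without changing the pinnacles

-- c goes just before the first entry that is below c or starts an ascent.  The entries
-- passed over are ≥ c and weakly decreasing, so no pinnacle is created or destroyed.
insert : ℤ → List ℤ → List ℤ
insert c [] = c ∷ []
insert c (y ∷ ys) with y <? c | y ≥ʰ? ys
... | no _ | yes _ = y ∷ insert c ys
... | _    | _     = c ∷ y ∷ ys

insert-↭ : ∀ c ys → insert c ys ↭ c ∷ ys
insert-↭ c [] = ↭-refl
insert-↭ c (y ∷ ys) with y <? c | y ≥ʰ? ys
... | no  _ | yes _ = ↭-trans (prep y (insert-↭ c ys)) (swap y c ↭-refl)
... | yes _ | _     = ↭-refl
... | no  _ | no  _ = ↭-refl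

insert-≥ʰ : ∀ {c x} ys → c ≤ x → x ≥ʰ ys → x ≥ʰ insert c ys
insert-≥ʰ [] c≤x _ = c≤x
insert-≥ʰ {c} (y ∷ ys) c≤x y≤x with y <? c | y ≥ʰ? ys
... | no  _ | yes _ = y≤x
... | yes _ | _     = c≤x
... | no  _ | no  _ = c≤x

insert-≈ₚ : ∀ c ys → insert c ys ≈ₚ ys
insert-≈ₚ c [] = prepend-≥ʰ tt
insert-≈ₚ c (y ∷ ys) with y <? c | y ≥ʰ? ys
... | no y≮c | yes y≥ys =
  ≈ₚ-trans (prepend-≥ʰ (insert-≥ʰ ys (ℤ.≮⇒≥ y≮c) y≥ys))
    (≈ₚ-trans (insert-≈ₚ c ys) (≈ₚ-sym (prepend-≥ʰ y≥ys)))
... | yes y<c | _       = prepend-≥ʰ (ℤ.<⇒≤ y<c)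
... | no  _   | no y≱ys = prepend-ascent y≱ys

-- Rearranging a word into negative entries

-∣_∣ : ℤ → ℤ
-∣ x ∣ = - + ∣ x ∣

-∣∣-nonPositive : ∀ {x} → x ≤ 0ℤ → -∣ x ∣ ≡ x
-∣∣-nonPositive {+ zero}    _        = refl
-∣∣-nonPositive {+ suc _}   (+≤+ ())
-∣∣-nonPositive { -[1+ _ ]} _        = refl

NegativeRearrangement : List ℤ → Set
NegativeRearrangement xs = ∃[ ys ] ys ↭ map -∣_∣ xs × ys ≈ₚ xs

negativeRearrangement-nonPositive : ∀ {xs} → All (_≤ 0ℤ) xs → NegativeRearrangement xs
negativeRearrangement-nonPositive {xs} xs≤0 =
  xs , ↭-reflexive (sym (List.map-id-local (All.map -∣∣-nonPositive xs≤0))) , ≈ₚ-refl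

negativeRearrangement-resp : ∀ {xs ys} → xs ↭ ys → xs ≈ₚ ys →
  NegativeRearrangement xs → NegativeRearrangement ys
negativeRearrangement-resp xs↭ys xs≈ys (zs , zs↭ , zs≈) =
  zs , ↭-trans zs↭ (↭.map⁺ -∣_∣ xs↭ys) , ≈ₚ-trans zs≈ xs≈ys

negativeRearrangement-∷ : ∀ {x xs} → x ≥ʰ xs →
  NegativeRearrangement xs → NegativeRearrangement (x ∷ xs)
negativeRearrangement-∷ {x} x≥xs (zs , zs↭ , zs≈) =
  insert -∣ x ∣ zs ,
  ↭-trans (insert-↭ -∣ x ∣ zs) (prep -∣ x ∣ zs↭) ,
  ≈ₚ-trans (insert-≈ₚ -∣ x ∣ zs) (≈ₚ-trans zs≈ (≈ₚ-sym (prepend-≥ʰ x≥xs)))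

data MaxSplit : List ℤ → Set where
  empty : MaxSplit []
  split : ∀ as M bs → All (_< M) as → All (_< M) bs → MaxSplit (as ++ M ∷ bs)

maxSplit : ∀ xs → Unique xs → MaxSplit xs
maxSplit [] _ = empty
maxSplit (x ∷ xs) (x∉xs ∷ xs-unique) with maxSplit xs xs-unique
... | empty = split [] x [] [] []
... | split as M bs as<M bs<M with ℤ.<-cmp x M
...   | tri< x<M _ _  = split (x ∷ as) M bs (x<M ∷ as<M) bs<M
...   | tri≈ _ refl _ = contradiction refl (All.lookup x∉xs (∈-++⁺ʳ as (here refl)))
...   | tri> _ _ M<x  = split [] x (as ++ M ∷ bs) [] (All.++⁺ (below as<M) (M<x ∷ below bs<M))
  where
  below : ∀ {ys} → All (_< M) ys → All (_< x) ys
  below = All.map (λ y<M → ℤ.<-trans y<M M<x)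

NonPositivePinnacles : List ℤ → Set
NonPositivePinnacles xs = ∀ v → Pinnacle xs v → v ≤ 0ℤ

positiveMax-toFront : ∀ as M bs → ¬ M ≤ 0ℤ → NonPositivePinnacles (as ++ M ∷ bs) →
  All (_< M) as → All (_< M) bs →
  ∃[ cs ] M ∷ cs ↭ as ++ M ∷ bs × M ∷ cs ≈ₚ as ++ M ∷ bs × M ≥ʰ cs
positiveMax-toFront [] M bs _ _ _ bs<M = bs , ↭-refl , ≈ₚ-refl , All<⇒≥ʰ bs<M
positiveMax-toFront as M [] _ _ as<M _ =
  reverse as ,
  subst (_↭ as ++ M ∷ []) reverse≡ (↭-reverse (as ++ M ∷ [])) ,
  subst (_≈ₚ as ++ M ∷ []) reverse≡ (reverse-≈ₚ (as ++ M ∷ [])) ,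
  All<⇒≥ʰ (All-resp-↭ (↭-sym (↭-reverse as)) as<M)
  where
  reverse≡ : reverse (as ++ M ∷ []) ≡ M ∷ reverse as
  reverse≡ = List.reverse-++ as (M ∷ [])
positiveMax-toFront (_ ∷ _) M (_ ∷ _) M≰0 pins≤0 as<M (b<M ∷ _) =
  contradiction (pins≤0 M (pinnacle-between as<M b<M)) M≰0

unique-resp-↭ : ∀ {xs ys : List ℤ} → xs ↭ ys → Unique xs → Unique ys
unique-resp-↭ xs↭ys = Unique-resp-↭ (setoid ℤ) (↭⇒↭ₛ xs↭ys)

negativeRearrangement : ∀ xs → Unique xs → NonPositivePinnacles xs → NegativeRearrangement xs
negativeRearrangement xs = go (length xs) xs ℕ.≤-refl
  where
  go : ∀ n xs → length xs ℕ.≤ n → Unique xs → NonPositivePinnacles xs → NegativeRearrangement xs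
  go zero [] _ _ _ = [] , ↭-refl , ≈ₚ-refl
  go (suc n) xs len xs-unique pins≤0 with maxSplit xs xs-unique
  ... | empty = [] , ↭-refl , ≈ₚ-refl
  ... | split as M bs as<M bs<M with M ≤? 0ℤ
  ...   | yes M≤0 = negativeRearrangement-nonPositive (All.++⁺ (below as<M) (M≤0 ∷ below bs<M))
    where
    below : ∀ {ys} → All (_< M) ys → All (_≤ 0ℤ) ys
    below = All.map (λ y<M → ℤ.<⇒≤ (ℤ.<-≤-trans y<M M≤0))
  ...   | no M≰0 with positiveMax-toFront as M bs M≰0 pins≤0 as<M bs<M
  ...     | cs , cs↭ , cs≈ , M≥cs =
    negativeRearrangement-resp cs↭ cs≈
      (negativeRearrangement-∷ M≥cs (go n cs cs-length cs-unique cs-pins≤0))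
    where
    cs-length : length cs ℕ.≤ n
    cs-length = ℕ.s≤s⁻¹ (subst (ℕ._≤ suc n) (sym (↭-length cs↭)) len)
    cs-unique : Unique cs
    cs-unique = Unique.drop⁺ 1 (unique-resp-↭ (↭-sym cs↭) xs-unique)
    cs-pins≤0 : NonPositivePinnacles cs
    cs-pins≤0 v p = pins≤0 v (Equivalence.to (cs≈ v) (Equivalence.from (prepend-≥ʰ M≥cs v) p))

-- Shifting by n + 1

shiftDown shiftUp : ℕ → ℤ → ℤ
shiftDown n x = x - + suc n
shiftUp   n y = y + + suc n

shiftDown-mono : ∀ n → shiftDown n Preserves _<_ ⟶ _<_
shiftDown-mono n = ℤ.+-monoˡ-< (- + suc n)

shiftUp-mono : ∀ n → shiftUp n Preserves _<_ ⟶ _<_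
shiftUp-mono n = ℤ.+-monoˡ-< (+ suc n)

shiftDown-injective : ∀ n → Injective _≡_ _≡_ (shiftDown n)
shiftDown-injective n = ∙-cancelʳ (- + suc n) _ _

shiftUp-injective : ∀ n → Injective _≡_ _≡_ (shiftUp n)
shiftUp-injective n = ∙-cancelʳ (+ suc n) _ _

shiftDown-shiftUp : ∀ n y → shiftDown n (shiftUp n y) ≡ y
shiftDown-shiftUp n y = //-rightDividesʳ (+ suc n) y

shiftUp-shiftDown : ∀ n x → shiftUp n (shiftDown n x) ≡ x
shiftUp-shiftDown n x = //-rightDividesˡ (+ suc n) x

NegInRange : ℕ → ℤ → Set
NegInRange n y = ∃[ k ] k ℕ.< n × y ≡ -[1+ k ]

shiftDown-negInRange : ∀ {n x} → + 1 ≤ x → x ≤ + n → NegInRange n (shiftDown n x)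
shiftDown-negInRange {x = + zero} (+≤+ ()) _
shiftDown-negInRange {n} {+ suc m} _ (+≤+ m<n) = n ℕ.∸ suc m , k<n , x↓≡-[1+k]
  where
  n∸m≡1+k : n ℕ.∸ m ≡ suc (n ℕ.∸ suc m)
  n∸m≡1+k = ℕ.+-∸-assoc 1 m<n
  k<n : n ℕ.∸ suc m ℕ.< n
  k<n = subst (ℕ._≤ n) n∸m≡1+k (ℕ.m∸n≤m n m)
  x↓≡-[1+k] : shiftDown n (+ suc m) ≡ -[1+ n ℕ.∸ suc m ]
  x↓≡-[1+k] = trans (ℤ.⊖-< (ℕ.s≤s m<n)) (cong (λ d → - + d) n∸m≡1+k)

shiftUp-inRange : ∀ {n y} → NegInRange n y → + 1 ≤ shiftUp n y × shiftUp n y ≤ + n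
shiftUp-inRange {n} (k , k<n , refl) rewrite ℤ.⊖-≥ (ℕ.s≤s (ℕ.<⇒≤ k<n)) =
  +≤+ (ℕ.m<n⇒0<n∸m k<n) , +≤+ (ℕ.m∸n≤m n k)

negInRange-∣∣ : ∀ {n y} → NegInRange n y → 1 ℕ.≤ ∣ y ∣ × ∣ y ∣ ℕ.≤ n
negInRange-∣∣ (_ , k<n , refl) = ℕ.s≤s ℕ.z≤n , k<n

negInRange-∣∣-injective : ∀ {m n x y} → NegInRange m x → NegInRange n y → ∣ x ∣ ≡ ∣ y ∣ → x ≡ y
negInRange-∣∣-injective (_ , _ , refl) (_ , _ , refl) ∣x∣≡∣y∣ =
  cong -[1+_] (ℕ.suc-injective ∣x∣≡∣y∣)

negInRange⇒<0 : ∀ {n y} → NegInRange n y → y < 0ℤ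
negInRange⇒<0 (_ , _ , refl) = -<+

-∣∣-negInRange : ∀ {n x} → 1 ℕ.≤ ∣ x ∣ → ∣ x ∣ ℕ.≤ n → NegInRange n -∣ x ∣
-∣∣-negInRange {x = + suc m}  _ ∣x∣≤n = m , ∣x∣≤n , refl
-∣∣-negInRange {x = -[1+ m ]} _ ∣x∣≤n = m , ∣x∣≤n , refl

lookup-injective : ∀ {A : Set} {xs : List A} → Unique xs → Injective _≡_ _≡_ (lookup xs)
lookup-injective (_ ∷ _)         {zero}  {zero}  _ = refl
lookup-injective (x∉xs ∷ _)      {zero}  {suc j} e = contradiction e (All.lookup x∉xs (∈-lookup j))
lookup-injective (x∉xs ∷ _)      {suc i} {zero}  e =
  contradiction (sym e) (All.lookup x∉xs (∈-lookup i))
lookup-injective (_ ∷ xs-unique) {suc i} {suc j} e = cong suc (lookup-injective xs-unique e)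

toAPSBneg : ∀ n → APS n → APSBneg n
toAPSBneg n (S , w , (w-range , w-injective) , S-pins) =
  map (shiftDown n) S , (shiftDown n ∘ w , (∣w↓∣-range , ∣w↓∣-injective) , S↓-pins) , S↓<0
  where
  w↓-range : ∀ i → NegInRange n (shiftDown n (w i))
  w↓-range i = shiftDown-negInRange (proj₁ (w-range i)) (proj₂ (w-range i))
  ∣w↓∣-range : ∀ i → 1 ℕ.≤ ∣ shiftDown n (w i) ∣ × ∣ shiftDown n (w i) ∣ ℕ.≤ n
  ∣w↓∣-range i = negInRange-∣∣ (w↓-range i)
  ∣w↓∣-injective : Injective _≡_ _≡_ (∣_∣ ∘ shiftDown n ∘ w)
  ∣w↓∣-injective {i} {j} e =
    w-injective (shiftDown-injective n (negInRange-∣∣-injective (w↓-range i) (w↓-range j) e))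
  S↓-pins : IsPinnacleSetOf (map (shiftDown n) S) (shiftDown n ∘ w)
  S↓-pins = isPinnacleSetOf-map (shiftDown-mono n) S-pins
  S↓<0 : ∀ v → v ∈ map (shiftDown n) S → v < 0ℤ
  S↓<0 v v∈ = isPinnacle-value (negInRange⇒<0 ∘ w↓-range) (Equivalence.to (S↓-pins v) v∈)

signedPerm-unique : ∀ {n} {u : OneLine n} → IsSignedPerm n u → Unique (map -∣_∣ (tabulate u))
signedPerm-unique {u = u} (_ , ∣u∣-injective) =
  subst Unique (sym (List.map-tabulate u -∣_∣))
    (Unique.tabulate⁺ (λ e → ∣u∣-injective (ℤ.+-injective (ℤ.neg-injective e))))

signedPerm-negInRange : ∀ {n} {u : OneLine n} → IsSignedPerm n u →
  All (NegInRange n) (map -∣_∣ (tabulate u))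
signedPerm-negInRange {u = u} (∣u∣-range , _) =
  All.map⁺ (All.tabulate⁺ (λ i → -∣∣-negInRange {x = u i} (proj₁ (∣u∣-range i)) (proj₂ (∣u∣-range i))))

shiftUp-lookup : ∀ n ys → length ys ≡ n → Unique ys → All (NegInRange n) ys → ∀ {T} →
  IsPinnacleSetOf T (lookup ys) → ∃[ w ] IsPerm n w × IsPinnacleSetOf (map (shiftUp n) T) w
shiftUp-lookup _ ys refl ys-unique ys-range T-pins =
  shiftUp _ ∘ lookup ys , (range , injective) , isPinnacleSetOf-map (shiftUp-mono _) T-pins
  where
  range : ∀ i → + 1 ≤ shiftUp (length ys) (lookup ys i) × shiftUp (length ys) (lookup ys i) ≤ + length ys
  range i = shiftUp-inRange (All.lookup ys-range (∈-lookup i))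
  injective : Injective _≡_ _≡_ (shiftUp (length ys) ∘ lookup ys)
  injective e = lookup-injective ys-unique (shiftUp-injective _ e)

fromAPSBneg : ∀ n → APSBneg n → APS n
fromAPSBneg n (T , (u , u-signed , T-pins) , T<0)
  with negativeRearrangement (tabulate u) (Unique.map⁻ (signedPerm-unique u-signed)) pins≤0
  where
  pins≤0 : NonPositivePinnacles (tabulate u)
  pins≤0 v p = ℤ.<⇒≤ (T<0 v (Equivalence.from (T-pins v) (pinnacle-tabulate⁻ p)))
... | ys , ys↭ , ys≈ =
  map (shiftUp n) T ,
  shiftUp-lookup n ys ys-length
    (unique-resp-↭ (↭-sym ys↭) (signedPerm-unique u-signed))
    (All-resp-↭ (↭-sym ys↭) (signedPerm-negInRange u-signed))
    (isPinnacleSetOf-lookup ys ys≈ T-pins)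
  where
  ys-length : length ys ≡ n
  ys-length = trans (↭-length ys↭) (trans (List.length-map -∣_∣ (tabulate u)) (List.length-tabulate u))

map-≐ : ∀ {f : ℤ → ℤ} {S T} → S ≐ T → map f S ≐ map f T
map-≐ S≐T _ = mk⇔ (⊆.map⁺ _ (Equivalence.to (S≐T _))) (⊆.map⁺ _ (Equivalence.from (S≐T _)))

map-≐-inverse : ∀ {f g : ℤ → ℤ} → (∀ x → g (f x) ≡ x) → ∀ {S T} → S ≐ map f T → map g S ≐ T
map-≐-inverse {f} {g} g∘f≗id {S} {T} S≐fT = subst (map g S ≐_) gfT≡T (map-≐ S≐fT)
  where
  gfT≡T : map g (map f T) ≡ T
  gfT≡T = trans (sym (List.map-∘ T)) (trans (List.map-cong g∘f≗id T) (List.map-id T))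

shift-inverse : ∀ n → Inverse (APS-setoid n) (APSBneg-setoid n)
shift-inverse n = record
  { to        = toAPSBneg n
  ; from      = fromAPSBneg n
  ; to-cong   = map-≐
  ; from-cong = map-≐
  ; inverse   = map-≐-inverse (shiftDown-shiftUp n) , map-≐-inverse (shiftUp-shiftDown n)
  }

lemma3p4 : (n : ℕ) → 1 ℕ.≤ n → Bijection (APS-setoid n) (APSBneg-setoid n)
lemma3p4 n _ = Inverse⇒Bijection (shift-inverse n)
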